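{- Let $(G,\Gamma,k)$ be an instance of \textsc{Dilation $2$-Augmentation} in which $\Gamma$ is a tree. Then for every solution $S$ of this instance, $E(\Gamma)\subseteq E(G+S)$.
   Context: Let $\Gamma$ be a finite undirected unweighted graph with vertex set $V$, and let $d_\Gamma(u,v)$ denote the shortest-path (hop) distance in $\Gamma$. A graph $G$ on the same vertex set $V$ is viewed as edge-weighted: each edge $(u,v)$ of $G$ has weight $d_\Gamma(u,v)$, and $d_G(u,v)$ denotes the weighted shortest-path distance in $G$. For a set $S$ of non-edges of $G$, $G+S=(V,E(G)\cup S)$ with the same weighting rule. $G+S$ has dilation at most $t$ if $d_{G+S}(u,v)\le t\cdot d_\Gamma(u,v)$ for all $u,v\in V$. \textsc{Dilation $t$-Augmentation}: given $(G,\Gamma,k)$, decide whether there is a set $S$ of at most $k$ non-edges of $G$ such that $G+S$ has dilation at most $t$; such a set $S$ is called a solution. -}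

module Defs where

open import Data.Nat using (ℕ; zero; suc; _+_; _*_; _≤_)
open import Data.Fin using (Fin)
open import Data.List using (List; []; _∷_; _++_; [_]; length)
open import Data.List.Relation.Unary.All using (All)
open import Data.List.Relation.Unary.Unique.Propositional using (Unique)
open import Data.List.Membership.Propositional using (_∈_)
open import Data.Product using (Σ; ∃; _×_; _,_)
open import Data.Sum using (_⊎_)
open import Relation.Binary.PropositionalEquality using (_≡_)
open import Relation.Nullary using (¬_)

record Graph (n : ℕ) : Set₁ where
  field
    Adj     : Fin n → Fin n → Set
    sym     : ∀ {u v} → Adj u v → Adj v u
    irrefl  : ∀ {u} → ¬ Adj u u
open Graph public

data Walk {n : ℕ} (E : Fin n → Fin n → Set) : Fin n → Fin n → ℕ → Set where
  here : ∀ {u} → Walk E u u zero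
  step : ∀ {u v w m} → E u v → Walk E v w m → Walk E u w (suc m)

IsDist : ∀ {n} → Graph n → Fin n → Fin n → ℕ → Set
IsDist Γ u v m = Walk (Adj Γ) u v m × (∀ m' → Walk (Adj Γ) u v m' → m ≤ m')

data Chain {n : ℕ} (E : Fin n → Fin n → Set) : List (Fin n) → Set where
  nil  : Chain E []
  one  : ∀ {x} → Chain E (x ∷ [])
  cons : ∀ {x y xs} → E x y → Chain E (y ∷ xs) → Chain E (x ∷ y ∷ xs)

HasCycle : ∀ {n} → Graph n → Set
HasCycle {n} Γ = Σ (Fin n) λ v → Σ (List (Fin n)) λ ws →
  Unique (v ∷ ws) × 2 ≤ length ws × Chain (Adj Γ) (v ∷ ws ++ [ v ])

Connected : ∀ {n} → Graph n → Set
Connected Γ = ∀ u v → ∃ λ m → Walk (Adj Γ) u v m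

IsTree : ∀ {n} → Graph n → Set
IsTree Γ = Connected Γ × ¬ HasCycle Γ

AdjPlus : ∀ {n} → Graph n → List (Fin n × Fin n) → Fin n → Fin n → Set
AdjPlus G S u v = Adj G u v ⊎ ((u , v) ∈ S ⊎ (v , u) ∈ S)

data WWalk {n : ℕ} (Γ : Graph n) (E : Fin n → Fin n → Set) : Fin n → Fin n → ℕ → Set where
  here : ∀ {u} → WWalk Γ E u u zero
  step : ∀ {u v w c m} → E u v → IsDist Γ u v c → WWalk Γ E v w m → WWalk Γ E u w (c + m)

DilationAtMost : ∀ {n} → ℕ → Graph n → Graph n → List (Fin n × Fin n) → Set
DilationAtMost t Γ G S = ∀ u v m → IsDist Γ u v m →
  ∃ λ w → WWalk Γ (AdjPlus G S) u v w × w ≤ t * m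

NonEdges : ∀ {n} → Graph n → List (Fin n × Fin n) → Set
NonEdges {n} G S = ∀ {u v : Fin n} → (u , v) ∈ S → ¬ (u ≡ v) × ¬ Adj G u v

IsSolution : ∀ {n} → ℕ → Graph n → Graph n → ℕ → List (Fin n × Fin n) → Set
IsSolution t G Γ k S = NonEdges G S × length S ≤ k × DilationAtMost t Γ G S

{-# OPTIONS --safe #-}
module Submission where

-- An edge uv of the tree Γ has d_Γ(u,v) = 1, so dilation 2 gives a walk from u to v in
-- G + S of weight at most 2.  Every edge of G + S joins distinct vertices and so has
-- weight at least 1; hence the walk is either the single edge uv, or two edges of
-- weight 1, i.e. a path u–x–v in Γ, which together with uv is a triangle in Γ.

open import Defs
open import Data.Nat using (ℕ; zero; suc; _+_; _≤_; z≤n; s≤s)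
open import Data.Nat.Properties using (m+n≤o⇒n≤o)
open import Data.Fin using (Fin)
open import Data.List using (List; []; _∷_)
open import Data.List.Relation.Unary.All using ([]; _∷_)
open import Data.List.Relation.Unary.AllPairs using ([]; _∷_)
open import Data.List.Relation.Unary.Unique.Propositional using (Unique)
open import Data.Product using (_×_; _,_; proj₁; ∃-syntax)
open import Data.Sum using (_⊎_; inj₁; inj₂)
open import Data.Empty using (⊥-elim)
open import Relation.Binary.Definitions using (Irreflexive)
open import Relation.Binary.PropositionalEquality using (_≡_; _≢_; refl) renaming (sym to ≡-sym)

positive-summands-≤2 : ∀ {a b m} → 1 ≤ a → 1 ≤ b → a + (b + m) ≤ 2 →
  a ≡ 1 × b ≡ 1 × m ≡ 0
positive-summands-≤2 {1} {1} {zero} _ _ _ = refl , refl , refl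
positive-summands-≤2 {1} {1} {suc _} _ _ (s≤s (s≤s ()))
positive-summands-≤2 {1} {suc (suc _)} _ _ (s≤s (s≤s ()))
positive-summands-≤2 {suc (suc a)} (s≤s z≤n) (s≤s z≤n) (s≤s (s≤s a+b+m≤0))
  with m+n≤o⇒n≤o a a+b+m≤0
... | ()

nonEdges⇒AdjPlus-irreflexive : ∀ {n} (G : Graph n) S → NonEdges G S →
  Irreflexive _≡_ (AdjPlus G S)
nonEdges⇒AdjPlus-irreflexive G S _        refl (inj₁ e)        = irrefl G e
nonEdges⇒AdjPlus-irreflexive G S nonEdges u≡v  (inj₂ (inj₁ p)) = proj₁ (nonEdges p) u≡v
nonEdges⇒AdjPlus-irreflexive G S nonEdges refl (inj₂ (inj₂ p)) = proj₁ (nonEdges p) refl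

module _ {n : ℕ} (Γ : Graph n) where

  adjacent⇒distinct : ∀ {u v} → Adj Γ u v → u ≢ v
  adjacent⇒distinct uv refl = irrefl Γ uv

  adjacent⇒dist-1 : ∀ {u v} → Adj Γ u v → IsDist Γ u v 1
  adjacent⇒dist-1 uv = step uv here , λ where
    _ here       → ⊥-elim (irrefl Γ uv)
    _ (step _ _) → s≤s z≤n

  dist-1⇒adjacent : ∀ {u v} → IsDist Γ u v 1 → Adj Γ u v
  dist-1⇒adjacent (step uv here , _) = uv

  distinct⇒dist-positive : ∀ {u v c} → u ≢ v → IsDist Γ u v c → 1 ≤ c
  distinct⇒dist-positive u≢v (here , _)     = ⊥-elim (u≢v refl)
  distinct⇒dist-positive _   (step _ _ , _) = s≤s z≤n

  triangle⇒hasCycle : ∀ {u v w} → Adj Γ u v → Adj Γ v w → Adj Γ w u → HasCycle Γ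
  triangle⇒hasCycle {u} {v} {w} uv vw wu =
    u , v ∷ w ∷ [] , distinct , s≤s (s≤s z≤n) , cons uv (cons vw (cons wu one))
    where
    distinct : Unique (u ∷ v ∷ w ∷ [])
    distinct = (adjacent⇒distinct uv ∷ (λ u≡w → adjacent⇒distinct wu (≡-sym u≡w)) ∷ [])
             ∷ (adjacent⇒distinct vw ∷ [])
             ∷ []
             ∷ []

  module _ {E : Fin n → Fin n → Set} (loopless : Irreflexive _≡_ E) where

    step-weight-positive : ∀ {u v c} → E u v → IsDist Γ u v c → 1 ≤ c
    step-weight-positive e = distinct⇒dist-positive (λ u≡v → loopless u≡v e)

    weight≤2-walk⇒edge⊎Γ-path₂ : ∀ {u v w} → u ≢ v → WWalk Γ E u v w → w ≤ 2 →
      E u v ⊎ ∃[ x ] Adj Γ u x × Adj Γ x v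
    weight≤2-walk⇒edge⊎Γ-path₂ u≢v here _ = ⊥-elim (u≢v refl)
    weight≤2-walk⇒edge⊎Γ-path₂ _ (step e _ here) _ = inj₁ e
    weight≤2-walk⇒edge⊎Γ-path₂ _ (step {v = x} e d (step e′ d′ here)) w≤2
      with positive-summands-≤2 (step-weight-positive e d) (step-weight-positive e′ d′) w≤2
    ... | refl , refl , _ = inj₂ (x , dist-1⇒adjacent d , dist-1⇒adjacent d′)
    weight≤2-walk⇒edge⊎Γ-path₂ _ (step e d (step e′ d′ (step e″ d″ _))) w≤2
      with positive-summands-≤2 (step-weight-positive e d) (step-weight-positive e′ d′) w≤2
         | step-weight-positive e″ d″
    ... | _ , _ , () | s≤s z≤n

mainTheorem7 : (n : ℕ) (G Γ : Graph n) (k : ℕ) → IsTree Γ →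
    (S : List (Fin n × Fin n)) → IsSolution 2 G Γ k S →
    ∀ u v → Adj Γ u v → AdjPlus G S u v
mainTheorem7 n G Γ k (_ , acyclic) S (nonEdges , _ , dilation) u v uv
  with dilation u v 1 (adjacent⇒dist-1 Γ uv)
... | _ , walk , w≤2
  with weight≤2-walk⇒edge⊎Γ-path₂ Γ (nonEdges⇒AdjPlus-irreflexive G S nonEdges)
         (adjacent⇒distinct Γ uv) walk w≤2
... | inj₁ e             = e
... | inj₂ (_ , ux , xv) = ⊥-elim (acyclic (triangle⇒hasCycle Γ ux xv (sym Γ uv)))
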